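{- Let $\delta$ be a probability distribution over the permutations of an $n$-element set $U$, and let $\rho$ be a permutation output by the Greedy-Rounding procedure on input $\delta$. Then for every $S\subseteq U$ with $|S|=r$, $$\rho(S)\le 2r\cdot\mathbb{E}_{\pi\sim\delta}[\pi(S)].$$
   Context: A permutation $\pi$ of $U$ gives each element $e$ a position $\pi[e]\in\{1,\dots,n\}$; for nonempty $S\subseteq U$, $\pi(S)=\min_{e\in S}\pi[e]$. Assume $r$ divides $n$. Greedy-Rounding on a distribution $\delta$: set $R\leftarrow U$; for $i=1,\dots,n/r$, choose $S^i$ among the $r$-element subsets of $R$ minimizing $\mathbb{E}_{\pi\sim\delta}[\pi(S^i)]$ (ties broken arbitrarily), place the elements of $S^i$ in arbitrary order at positions $(i-1)r+1,\dots,ir$ of $\rho$, and set $R\leftarrow R\setminus S^i$. Output $\rho$.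
   Formalization: The probabilities that the distribution δ assigns to the permutations of U are rational numbers. -}

module Defs where

open import Data.Bool using (Bool; if_then_else_)
open import Data.Nat as ℕ using (ℕ; suc; _⊓_; _*_; _<_)
open import Data.Integer using (+_)
open import Data.Rational as ℚ using (ℚ; _/_; 0ℚ; 1ℚ; _≤_)
open import Data.Fin using (Fin; toℕ)
open import Data.Fin.Subset using (Subset; _∈_; _⊆_; ∣_∣)
open import Data.Fin.Subset.Properties using (_∈?_)
open import Data.Fin.Permutation using (Permutation′; _⟨$⟩ʳ_)
open import Data.List using (List; foldr; map; filter; allFin)
open import Data.List.Relation.Unary.All using (All)
open import Data.Product using (_×_; _,_; proj₁; proj₂)
open import Data.Vec using (tabulate)
open import Relation.Binary.PropositionalEquality using (_≡_)
open import Relation.Nullary.Decidable using (⌊_⌋)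

toℚ : ℕ → ℚ
toℚ m = + m / 1

-- position of e under π, in {1,…,n}
pos : ∀ {n} → Permutation′ n → Fin n → ℕ
pos π e = suc (toℕ (π ⟨$⟩ʳ e))

-- π(S) = min_{e ∈ S} π[e]  (value suc n for the empty set; only used on nonempty S)
minPos : ∀ {n} → Permutation′ n → Subset n → ℕ
minPos {n} π S = foldr _⊓_ (suc n) (map (pos π) (filter (_∈? S) (allFin n)))

Dist : ℕ → Set
Dist n = List (ℚ × Permutation′ n)

totalWeight : ∀ {n} → Dist n → ℚ
totalWeight = foldr (λ wp acc → proj₁ wp ℚ.+ acc) 0ℚ

IsProbDist : ∀ {n} → Dist n → Set
IsProbDist δ = All (λ wp → 0ℚ ≤ proj₁ wp) δ × totalWeight δ ≡ 1ℚ

expect : ∀ {n} → Dist n → Subset n → ℚ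
expect δ S = foldr (λ wp acc → proj₁ wp ℚ.* toℚ (minPos (proj₂ wp) S) ℚ.+ acc) 0ℚ δ

-- Elements placed by ρ at (1-indexed) positions > i·r, i.e. R before round i+1.
remaining : ∀ {n} → ℕ → ℕ → Permutation′ n → Subset n
remaining r i ρ = tabulate (λ e → ⌊ i * r ℕ.≤? toℕ (ρ ⟨$⟩ʳ e) ⌋)

-- Elements placed by ρ at (1-indexed) positions i·r+1,…,(i+1)·r, i.e. S^{i+1}.
block : ∀ {n} → ℕ → ℕ → Permutation′ n → Subset n
block r i ρ = tabulate (λ e → ⌊ i * r ℕ.≤? toℕ (ρ ⟨$⟩ʳ e) ⌋ Data.Bool.∧ ⌊ toℕ (ρ ⟨$⟩ʳ e) ℕ.<? suc i * r ⌋)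
  where import Data.Bool

-- ρ is a possible output of Greedy-Rounding (block size r) on δ:
-- for every round i+1 (0 ≤ i < n/r), the set S^{i+1} placed at positions
-- i·r+1,…,(i+1)·r minimizes E[π(·)] among all r-subsets of the remaining set R.
GreedyOutput : ∀ {n} → ℕ → Dist n → Permutation′ n → Set
GreedyOutput {n} r δ ρ =
  ∀ (i : ℕ) → i * r < n →
  ∀ (T : Subset n) → T ⊆ remaining r i ρ → ∣ T ∣ ≡ r →
  expect δ (block r i ρ) ≤ expect δ T

-- Let s be the first element of S in ρ, at 0-based position p, and k = ⌊p/r⌋. The k blocks that
-- Greedy-Rounding placed before s were each chosen while S was still an available candidate, so each
-- has expected minimum at most E = E[π(S)]. Together with S they form k+1 pairwise disjoint nonempty
-- sets; under any π their minima are attained at distinct positions, so these minima sum to at least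
-- 1 + ⋯ + (k+1). Taking expectations gives (k+1)(k+2)/2 ≤ (k+1)E, i.e. k+2 ≤ 2E, and therefore
-- ρ(S) = p+1 ≤ (k+1)r < (k+2)r ≤ 2rE.
module Submission where

open import Defs
open import Data.Nat using (ℕ)
open import Data.Nat.Divisibility using (_∣_)
open import Data.Rational using (ℚ)
open import Data.Fin.Subset using (Subset; ∣_∣)
open import Data.Fin.Permutation using (Permutation′)
open import Relation.Binary.PropositionalEquality using (_≡_)

open import Algebra.Bundles using (CommutativeMonoid)
import Algebra.Properties.CommutativeSemigroup as CommSemigroupProperties
open import Data.Bool using (Bool; T)
open import Data.Bool.Properties using (T-≡; T-∧)
open import Data.Empty using (⊥-elim)
open import Data.Fin using (Fin; zero; suc; toℕ; fromℕ<; punchIn)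
import Data.Fin.Properties as Fin
open import Data.Fin.Subset using (_∈_; _⊆_; Nonempty)
import Data.Fin.Subset.Properties as Subset
open import Data.Fin.Subset.Properties using (_∈?_)
open import Data.Fin.Permutation using (_⟨$⟩ʳ_; _⟨$⟩ˡ_; inverseʳ)
open import Data.Integer as ℤ using (+_)
import Data.Integer.Properties as ℤ
open import Data.List using (List; []; _∷_; foldr; map; filter; allFin)
open import Data.List.Membership.Propositional using () renaming (_∈_ to _∈ₗ_)
open import Data.List.Membership.Propositional.Properties using (∈-map⁺; ∈-map⁻; ∈-filter⁺; ∈-filter⁻; ∈-allFin)
open import Data.List.Relation.Unary.All using (All; []; _∷_)
open import Data.List.Relation.Unary.Any using (here; there)
open import Data.Nat as ℕ using (suc; zero; _+_; _*_; _≤_; _<_; _⊓_; z≤n; s≤s; NonZero)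
import Data.Nat.Coprimality as Coprime
open import Data.Nat.DivMod using (_/_; m≡m%n+[m/n]*n; m%n<n; m/n*n≤m)
import Data.Nat.Properties as ℕ
open import Data.Nat.Solver using (module +-*-Solver)
open import Data.Product using (_×_; _,_; proj₁; proj₂; ∃)
open import Data.Rational as ℚ using (mkℚ; 0ℚ; 1ℚ)
import Data.Rational.Properties as ℚ
open import Data.Sum using (_⊎_; inj₁; inj₂)
open import Data.Vec using (tabulate)
import Data.Vec.Properties as Vec
open import Data.Vec.Functional using (removeAt) renaming (_∷_ to _◂_)
open import Function using (_∘_)
open import Function.Bundles using (Injection; Equivalence)
open import Function.Properties.Inverse using (↔⇒↣)
open import Function.Definitions using (Injective)
open import Relation.Binary.PropositionalEquality using (refl; sym; trans; cong; cong₂; subst; subst₂; module ≡-Reasoning)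
open import Relation.Nullary using (yes; no)
open import Relation.Nullary.Decidable using (toWitness; fromWitness)

open import Algebra.Properties.CommutativeMonoid.Sum ℕ.+-0-commutativeMonoid using (sum; sum-remove; sum-cong-≗)

-- Exposing toℚ m as the already normalised m/1 makes ℚ's _+_ and _*_ reduce to ℤ arithmetic.
toℚ≡mkℚ : ∀ m → toℚ m ≡ mkℚ (+ m) 0 (Coprime.sym (Coprime.1-coprimeTo m))
toℚ≡mkℚ m = ℚ.normalize-coprime (Coprime.sym (Coprime.1-coprimeTo m))

toℚ-homo-+ : ∀ m n → toℚ (m + n) ≡ toℚ m ℚ.+ toℚ n
toℚ-homo-+ m n = begin
  + (m + n) ℚ./ 1                       ≡⟨ cong (ℚ._/ 1) (trans (ℤ.pos-+ m n) (sym (cong₂ ℤ._+_ (ℤ.*-identityʳ (+ m)) (ℤ.*-identityʳ (+ n))))) ⟩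
  (+ m ℤ.* + 1 ℤ.+ + n ℤ.* + 1) ℚ./ 1   ≡⟨ sym (cong₂ ℚ._+_ (toℚ≡mkℚ m) (toℚ≡mkℚ n)) ⟩
  toℚ m ℚ.+ toℚ n                       ∎
  where open ≡-Reasoning

toℚ-homo-* : ∀ m n → toℚ (m * n) ≡ toℚ m ℚ.* toℚ n
toℚ-homo-* m n = begin
  + (m * n) ℚ./ 1        ≡⟨ cong (ℚ._/ 1) (ℤ.pos-* m n) ⟩
  (+ m ℤ.* + n) ℚ./ 1    ≡⟨ sym (cong₂ ℚ._*_ (toℚ≡mkℚ m) (toℚ≡mkℚ n)) ⟩
  toℚ m ℚ.* toℚ n        ∎
  where open ≡-Reasoning

toℚ-mono-≤ : ∀ {m n} → m ≤ n → toℚ m ℚ.≤ toℚ n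
toℚ-mono-≤ {m} {n} m≤n rewrite toℚ≡mkℚ m | toℚ≡mkℚ n =
  ℚ.*≤* (subst₂ ℤ._≤_ (sym (ℤ.*-identityʳ (+ m))) (sym (ℤ.*-identityʳ (+ n))) (ℤ.+≤+ m≤n))

-- expect δ S is definitionally expectation δ (λ π → minPos π S).
expectation : ∀ {n} → Dist n → (Permutation′ n → ℕ) → ℚ
expectation δ f = foldr (λ wp acc → proj₁ wp ℚ.* toℚ (f (proj₂ wp)) ℚ.+ acc) 0ℚ δ

expectation-+ : ∀ {n} (δ : Dist n) f g →
  expectation δ (λ π → f π + g π) ≡ expectation δ f ℚ.+ expectation δ g
expectation-+ [] f g = sym (ℚ.+-identityˡ 0ℚ)
expectation-+ ((w , π) ∷ δ) f g = begin
  w ℚ.* toℚ (f π + g π) ℚ.+ expectation δ (λ π → f π + g π)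
    ≡⟨ cong₂ ℚ._+_ (trans (cong (w ℚ.*_) (toℚ-homo-+ (f π) (g π))) (ℚ.*-distribˡ-+ w _ _)) (expectation-+ δ f g) ⟩
  (w ℚ.* toℚ (f π) ℚ.+ w ℚ.* toℚ (g π)) ℚ.+ (expectation δ f ℚ.+ expectation δ g)
    ≡⟨ interchange (w ℚ.* toℚ (f π)) _ _ _ ⟩
  (w ℚ.* toℚ (f π) ℚ.+ expectation δ f) ℚ.+ (w ℚ.* toℚ (g π) ℚ.+ expectation δ g) ∎
  where
  open ≡-Reasoning
  open CommSemigroupProperties (CommutativeMonoid.commutativeSemigroup ℚ.+-0-commutativeMonoid) using (interchange)

expectation-*ˡ : ∀ {n} (δ : Dist n) a f → expectation δ (λ π → a * f π) ≡ toℚ a ℚ.* expectation δ f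
expectation-*ˡ [] a f = sym (ℚ.*-zeroʳ (toℚ a))
expectation-*ˡ ((w , π) ∷ δ) a f = begin
  w ℚ.* toℚ (a * f π) ℚ.+ expectation δ (λ π → a * f π)
    ≡⟨ cong₂ ℚ._+_ (cong (w ℚ.*_) (toℚ-homo-* a (f π))) (expectation-*ˡ δ a f) ⟩
  w ℚ.* (toℚ a ℚ.* toℚ (f π)) ℚ.+ toℚ a ℚ.* expectation δ f
    ≡⟨ cong (ℚ._+ _) (x∙yz≈y∙xz w (toℚ a) (toℚ (f π))) ⟩
  toℚ a ℚ.* (w ℚ.* toℚ (f π)) ℚ.+ toℚ a ℚ.* expectation δ f
    ≡⟨ sym (ℚ.*-distribˡ-+ (toℚ a) _ _) ⟩
  toℚ a ℚ.* (w ℚ.* toℚ (f π) ℚ.+ expectation δ f) ∎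
  where
  open ≡-Reasoning
  open CommSemigroupProperties (CommutativeMonoid.commutativeSemigroup ℚ.*-1-commutativeMonoid) using (x∙yz≈y∙xz)

expectation-0 : ∀ {n} (δ : Dist n) → expectation δ (λ _ → 0) ≡ 0ℚ
expectation-0 [] = refl
expectation-0 ((w , π) ∷ δ) = trans (cong₂ ℚ._+_ (ℚ.*-zeroʳ w) (expectation-0 δ)) (ℚ.+-identityˡ 0ℚ)

expectation-sum≤ : ∀ {n c} (δ : Dist n) (f : Fin c → Permutation′ n → ℕ) E →
  (∀ j → expectation δ (f j) ℚ.≤ E) → expectation δ (λ π → sum (λ j → f j π)) ℚ.≤ toℚ c ℚ.* E
expectation-sum≤ {c = zero} δ f E _ = ℚ.≤-reflexive (trans (expectation-0 δ) (sym (ℚ.*-zeroˡ E)))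
expectation-sum≤ {c = suc c} δ f E f≤E = begin
  expectation δ (λ π → f zero π + sum (λ j → f (suc j) π))
    ≡⟨ expectation-+ δ (f zero) _ ⟩
  expectation δ (f zero) ℚ.+ expectation δ (λ π → sum (λ j → f (suc j) π))
    ≤⟨ ℚ.+-mono-≤ (f≤E zero) (expectation-sum≤ δ (f ∘ suc) E (f≤E ∘ suc)) ⟩
  E ℚ.+ toℚ c ℚ.* E
    ≡⟨ cong (ℚ._+ toℚ c ℚ.* E) (sym (ℚ.*-identityˡ E)) ⟩
  1ℚ ℚ.* E ℚ.+ toℚ c ℚ.* E
    ≡⟨ sym (ℚ.*-distribʳ-+ E 1ℚ (toℚ c)) ⟩
  (1ℚ ℚ.+ toℚ c) ℚ.* E
    ≡⟨ cong (ℚ._* E) (sym (toℚ-homo-+ 1 c)) ⟩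
  toℚ (suc c) ℚ.* E ∎
  where open ℚ.≤-Reasoning

*-totalWeight≤expectation : ∀ {n} (δ : Dist n) m f → All (λ wp → 0ℚ ℚ.≤ proj₁ wp) δ →
  (∀ π → m ≤ f π) → toℚ m ℚ.* totalWeight δ ℚ.≤ expectation δ f
*-totalWeight≤expectation [] m f _ _ = ℚ.≤-reflexive (ℚ.*-zeroʳ (toℚ m))
*-totalWeight≤expectation ((w , π) ∷ δ) m f (0≤w ∷ 0≤δ) m≤f = begin
  toℚ m ℚ.* (w ℚ.+ totalWeight δ)              ≡⟨ ℚ.*-distribˡ-+ (toℚ m) w _ ⟩
  toℚ m ℚ.* w ℚ.+ toℚ m ℚ.* totalWeight δ      ≡⟨ cong (ℚ._+ _) (ℚ.*-comm (toℚ m) w) ⟩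
  w ℚ.* toℚ m ℚ.+ toℚ m ℚ.* totalWeight δ      ≤⟨ ℚ.+-mono-≤ (ℚ.*-monoˡ-≤-nonNeg w {{ℚ.nonNegative 0≤w}} (toℚ-mono-≤ (m≤f π)))
                                                                  (*-totalWeight≤expectation δ m f 0≤δ m≤f) ⟩
  w ℚ.* toℚ (f π) ℚ.+ expectation δ f          ∎
  where open ℚ.≤-Reasoning

bounded-injective⇒≤ : ∀ {c B} (g : Fin c → ℕ) → Injective _≡_ _≡_ g → (∀ j → g j < B) → c ≤ B
bounded-injective⇒≤ g g-inj g<B = Fin.injective⇒≤ {f = λ j → fromℕ< (g<B j)} λ {i} {j} eq → g-inj (begin
  g i                   ≡⟨ sym (Fin.toℕ-fromℕ< (g<B i)) ⟩
  toℕ (fromℕ< (g<B i))  ≡⟨ cong toℕ eq ⟩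
  toℕ (fromℕ< (g<B j))  ≡⟨ Fin.toℕ-fromℕ< (g<B j) ⟩
  g j                   ∎)
  where open ≡-Reasoning

-- Induction on the bound: if the top value B is taken, remove it; the remaining values are < B.
injective⇒triangular≤sum : ∀ B {c} (g : Fin c → ℕ) → Injective _≡_ _≡_ g → (∀ j → g j < B) →
  c * suc c ≤ 2 * sum (suc ∘ g)
injective⇒triangular≤sum _ {zero} _ _ _ = z≤n
injective⇒triangular≤sum zero {suc c} g _ g<0 with g<0 zero
... | ()
injective⇒triangular≤sum (suc B) {suc c} g g-inj g<1+B with Fin.any? (λ j → g j ℕ.≟ B)
... | no ∄j = injective⇒triangular≤sum B g g-inj
                (λ j → ℕ.≤∧≢⇒< (ℕ.m<1+n⇒m≤n (g<1+B j)) (λ gj≡B → ∄j (j , gj≡B)))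
... | yes (j , gj≡B) = begin
  suc c * suc (suc c)              ≡⟨ solve 1 (λ c → (con 1 :+ c) :* (con 2 :+ c) := c :* (con 1 :+ c) :+ con 2 :* (con 1 :+ c)) refl c ⟩
  c * suc c + 2 * suc c            ≤⟨ ℕ.+-mono-≤ ih (ℕ.*-monoʳ-≤ 2 (s≤s c≤B)) ⟩
  2 * sum (suc ∘ g′) + 2 * suc B   ≡⟨ sym (ℕ.*-distribˡ-+ 2 (sum (suc ∘ g′)) (suc B)) ⟩
  2 * (sum (suc ∘ g′) + suc B)     ≡⟨ cong (2 *_) (ℕ.+-comm (sum (suc ∘ g′)) (suc B)) ⟩
  2 * (suc B + sum (suc ∘ g′))     ≡⟨ cong (λ x → 2 * (suc x + sum (suc ∘ g′))) (sym gj≡B) ⟩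
  2 * (suc (g j) + sum (suc ∘ g′)) ≡⟨ cong (2 *_) (sym (sum-remove (suc ∘ g))) ⟩
  2 * sum (suc ∘ g)                ∎
  where
  open ℕ.≤-Reasoning
  open +-*-Solver
  g′ : Fin c → ℕ
  g′ = removeAt g j
  g′<B : ∀ i → g′ i < B
  g′<B i = ℕ.≤∧≢⇒< (ℕ.m<1+n⇒m≤n (g<1+B (punchIn j i)))
                   (λ g′i≡B → Fin.punchInᵢ≢i j i (g-inj (trans g′i≡B (sym gj≡B))))
  ih : c * suc c ≤ 2 * sum (suc ∘ g′)
  ih = injective⇒triangular≤sum B g′ (Fin.punchIn-injective j _ _ ∘ g-inj) g′<B
  c≤B : c ≤ B
  c≤B = ℕ.≤-pred (bounded-injective⇒≤ g g-inj g<1+B)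

foldr-⊓-≤ : ∀ z {xs : List ℕ} {x} → x ∈ₗ xs → foldr _⊓_ z xs ≤ x
foldr-⊓-≤ z {y ∷ _} (here refl) = ℕ.m⊓n≤m y _
foldr-⊓-≤ z {y ∷ _} (there x∈ys) = ℕ.≤-trans (ℕ.m⊓n≤n y _) (foldr-⊓-≤ z x∈ys)

foldr-⊓-sel : ∀ z (xs : List ℕ) → foldr _⊓_ z xs ≡ z ⊎ foldr _⊓_ z xs ∈ₗ xs
foldr-⊓-sel z [] = inj₁ refl
foldr-⊓-sel z (y ∷ ys) with ℕ.⊓-sel y (foldr _⊓_ z ys)
... | inj₁ eq = inj₂ (here eq)
... | inj₂ eq with foldr-⊓-sel z ys
...   | inj₁ eq′ = inj₁ (trans eq eq′)
...   | inj₂ ∈ys = inj₂ (there (subst (_∈ₗ ys) (sym eq) ∈ys))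

minPos≤pos : ∀ {n} (π : Permutation′ n) {S : Subset n} {e} → e ∈ S → minPos π S ≤ pos π e
minPos≤pos π {S} {e} e∈S = foldr-⊓-≤ _ (∈-map⁺ (pos π) (∈-filter⁺ (_∈? S) (∈-allFin e) e∈S))

minPos-attained : ∀ {n} (π : Permutation′ n) {S : Subset n} → Nonempty S →
  ∃ λ s → s ∈ S × minPos π S ≡ pos π s
minPos-attained {n} π {S} (e , e∈S) with foldr-⊓-sel (suc n) (map (pos π) (filter (_∈? S) (allFin n)))
... | inj₁ minPos≡1+n = ⊥-elim (ℕ.<-irrefl minPos≡1+n (s≤s (ℕ.≤-trans (minPos≤pos π e∈S) (Fin.toℕ<n (π ⟨$⟩ʳ e)))))
... | inj₂ minPos∈ with ∈-map⁻ (pos π) minPos∈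
...   | s , s∈ , eq = s , proj₂ (∈-filter⁻ (_∈? S) {xs = allFin n} s∈) , eq

∣p∣>0⇒Nonempty : ∀ {n} (p : Subset n) → 0 < ∣ p ∣ → Nonempty p
∣p∣>0⇒Nonempty {n} p 0<∣p∣ with Subset.nonempty? p
... | yes p≢∅ = p≢∅
... | no p≡∅ = ⊥-elim (ℕ.<⇒≢ 0<∣p∣ (sym (trans (cong ∣_∣ (Subset.Empty-unique p≡∅)) (Subset.∣⊥∣≡0 n))))

PairwiseDisjoint : ∀ {n c} → (Fin c → Subset n) → Set
PairwiseDisjoint T = ∀ {i j e} → e ∈ T i → e ∈ T j → i ≡ j

-- The minima π(T j) are attained at distinct elements, hence are c distinct positive integers.
triangular≤sum-minPos : ∀ {n c} (π : Permutation′ n) (T : Fin c → Subset n) →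
  (∀ j → Nonempty (T j)) → PairwiseDisjoint T → c * suc c ≤ 2 * sum (λ j → minPos π (T j))
triangular≤sum-minPos {n} {c} π T nonempty disjoint =
  subst (λ x → _ ≤ 2 * x) (sum-cong-≗ (sym ∘ minPos≡pos)) (injective⇒triangular≤sum n g g-inj (Fin.toℕ<n ∘ (π ⟨$⟩ʳ_) ∘ argmin))
  where
  argmin : ∀ j → Fin n
  argmin j = proj₁ (minPos-attained π (nonempty j))
  argmin∈T : ∀ j → argmin j ∈ T j
  argmin∈T j = proj₁ (proj₂ (minPos-attained π (nonempty j)))
  minPos≡pos : ∀ j → minPos π (T j) ≡ pos π (argmin j)
  minPos≡pos j = proj₂ (proj₂ (minPos-attained π (nonempty j)))
  g : Fin c → ℕ
  g j = toℕ (π ⟨$⟩ʳ argmin j)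
  g-inj : Injective _≡_ _≡_ g
  g-inj {i} {j} gi≡gj = disjoint (argmin∈T i)
    (subst (_∈ T j) (sym (Injection.injective (↔⇒↣ π) (Fin.toℕ-injective gi≡gj))) (argmin∈T j))

disjoint-family-bound : ∀ {n c} (δ : Dist n) → IsProbDist δ → (T : Fin (suc c) → Subset n) →
  (∀ j → Nonempty (T j)) → PairwiseDisjoint T →
  ∀ E → (∀ j → expect δ (T j) ℚ.≤ E) → toℚ (2 + c) ℚ.≤ toℚ 2 ℚ.* E
disjoint-family-bound {c = c} δ (0≤w , total≡1) T nonempty disjoint E T≤E =
  ℚ.*-cancelˡ-≤-pos (toℚ (suc c)) {{ℚ.normalize-pos (suc c) 1}} (begin
    toℚ (suc c) ℚ.* toℚ (2 + c)                         ≡⟨ sym (toℚ-homo-* (suc c) (2 + c)) ⟩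
    toℚ (suc c * (2 + c))                               ≡⟨ sym (trans (cong (toℚ (suc c * (2 + c)) ℚ.*_) total≡1) (ℚ.*-identityʳ _)) ⟩
    toℚ (suc c * (2 + c)) ℚ.* totalWeight δ             ≤⟨ *-totalWeight≤expectation δ _ (λ π → 2 * sum (λ j → minPos π (T j))) 0≤w
                                                             (λ π → triangular≤sum-minPos π T nonempty disjoint) ⟩
    expectation δ (λ π → 2 * sum (λ j → minPos π (T j))) ≡⟨ expectation-*ˡ δ 2 (λ π → sum (λ j → minPos π (T j))) ⟩
    toℚ 2 ℚ.* expectation δ (λ π → sum (λ j → minPos π (T j)))
                                                        ≤⟨ ℚ.*-monoˡ-≤-nonNeg (toℚ 2) {{ℚ.normalize-nonNeg 2 1}} (expectation-sum≤ δ (λ j π → minPos π (T j)) E T≤E) ⟩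
    toℚ 2 ℚ.* (toℚ (suc c) ℚ.* E)                       ≡⟨ x∙yz≈y∙xz (toℚ 2) (toℚ (suc c)) E ⟩
    toℚ (suc c) ℚ.* (toℚ 2 ℚ.* E)                       ∎)
  where
  open ℚ.≤-Reasoning
  open CommSemigroupProperties (CommutativeMonoid.commutativeSemigroup ℚ.*-1-commutativeMonoid) using (x∙yz≈y∙xz)

∈-tabulate⁺ : ∀ {n} {f : Fin n → Bool} {e} → T (f e) → e ∈ tabulate f
∈-tabulate⁺ {f = f} {e} t = Vec.lookup⇒[]= e (tabulate f) (trans (Vec.lookup∘tabulate f e) (Equivalence.to T-≡ t))

∈-tabulate⁻ : ∀ {n} {f : Fin n → Bool} {e} → e ∈ tabulate f → T (f e)
∈-tabulate⁻ {f = f} {e} e∈ = Equivalence.from T-≡ (trans (sym (Vec.lookup∘tabulate f e)) (Vec.[]=⇒lookup e∈))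

m<[1+m/n]*n : ∀ m n .{{_ : NonZero n}} → m < suc (m / n) * n
m<[1+m/n]*n m n = subst (_< suc (m / n) * n) (sym (m≡m%n+[m/n]*n m n)) (ℕ.+-monoˡ-< ((m / n) * n) (m%n<n m n))

*-interval⇒≤ : ∀ r {i j x} → i * r ≤ x → x < suc j * r → i ≤ j
*-interval⇒≤ r ir≤x x<[1+j]r = ℕ.m<1+n⇒m≤n (ℕ.*-cancelʳ-< r _ _ (ℕ.≤-<-trans ir≤x x<[1+j]r))

module _ {n} (r : ℕ) (ρ : Permutation′ n) where

  private
    at : Fin n → ℕ
    at e = toℕ (ρ ⟨$⟩ʳ e)

  ∈-remaining⁺ : ∀ {i e} → i * r ≤ at e → e ∈ remaining r i ρ
  ∈-remaining⁺ {i} {e} = ∈-tabulate⁺ ∘ fromWitness {a? = i * r ℕ.≤? at e}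

  ∈-remaining⁻ : ∀ {i e} → e ∈ remaining r i ρ → i * r ≤ at e
  ∈-remaining⁻ {i} {e} = toWitness {a? = i * r ℕ.≤? at e} ∘ ∈-tabulate⁻

  remaining-antitone : ∀ {i j} → i ≤ j → remaining r j ρ ⊆ remaining r i ρ
  remaining-antitone {i} {j} i≤j = ∈-remaining⁺ {i} ∘ ℕ.≤-trans (ℕ.*-monoˡ-≤ r i≤j) ∘ ∈-remaining⁻ {j}

  ∈-block⁺ : ∀ {i e} → i * r ≤ at e → at e < suc i * r → e ∈ block r i ρ
  ∈-block⁺ {i} {e} ir≤e e<[1+i]r =
    ∈-tabulate⁺ (Equivalence.from T-∧ (fromWitness {a? = i * r ℕ.≤? at e} ir≤e , fromWitness {a? = at e ℕ.<? suc i * r} e<[1+i]r))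

  ∈-block⁻ : ∀ {i e} → e ∈ block r i ρ → i * r ≤ at e × at e < suc i * r
  ∈-block⁻ {i} {e} e∈ with Equivalence.to T-∧ (∈-tabulate⁻ e∈)
  ... | ir≤e , e<[1+i]r = toWitness {a? = i * r ℕ.≤? at e} ir≤e , toWitness {a? = at e ℕ.<? suc i * r} e<[1+i]r

  block-nonempty : ∀ {i} .{{_ : NonZero r}} → i * r < n → Nonempty (block r i ρ)
  block-nonempty {i} ir<n = e , ∈-block⁺ {i} (ℕ.≤-reflexive (sym at-e)) (subst (_< suc i * r) (sym at-e) (ℕ.m<n+m (i * r) (ℕ.>-nonZero⁻¹ r)))
    where
    e : Fin n
    e = ρ ⟨$⟩ˡ fromℕ< ir<n
    at-e : at e ≡ i * r
    at-e = trans (cong toℕ (inverseʳ ρ)) (Fin.toℕ-fromℕ< ir<n)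

  block-disjoint : ∀ {i j e} → e ∈ block r i ρ → e ∈ block r j ρ → i ≡ j
  block-disjoint {i} {j} e∈i e∈j with ∈-block⁻ {i} e∈i | ∈-block⁻ {j} e∈j
  ... | ir≤e , e<[1+i]r | jr≤e , e<[1+j]r = ℕ.≤-antisym (*-interval⇒≤ r ir≤e e<[1+j]r) (*-interval⇒≤ r jr≤e e<[1+i]r)

  ∈-remaining-∈-block⇒≤ : ∀ {i j e} → e ∈ remaining r i ρ → e ∈ block r j ρ → i ≤ j
  ∈-remaining-∈-block⇒≤ {i} {j} e∈R e∈B = *-interval⇒≤ r (∈-remaining⁻ {i} e∈R) (proj₂ (∈-block⁻ {j} e∈B))

module S∷Blocks {n r} (ρ : Permutation′ n) {S : Subset n} {k} (S⊆R : S ⊆ remaining r k ρ) where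

  S∷blocks : Fin (suc k) → Subset n
  S∷blocks = S ◂ λ j → block r (toℕ j) ρ

  S∷blocks-disjoint : PairwiseDisjoint S∷blocks
  S∷blocks-disjoint {zero}  {zero}  _   _   = refl
  S∷blocks-disjoint {zero}  {suc j} e∈S e∈B = ⊥-elim (ℕ.<⇒≱ (Fin.toℕ<n j) (∈-remaining-∈-block⇒≤ r ρ {k} (S⊆R e∈S) e∈B))
  S∷blocks-disjoint {suc i} {zero}  e∈B e∈S = ⊥-elim (ℕ.<⇒≱ (Fin.toℕ<n i) (∈-remaining-∈-block⇒≤ r ρ {k} (S⊆R e∈S) e∈B))
  S∷blocks-disjoint {suc i} {suc j} e∈i e∈j = cong suc (Fin.toℕ-injective (block-disjoint r ρ {toℕ i} {toℕ j} e∈i e∈j))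

  private
    block-start<n : Nonempty S → (j : Fin k) → toℕ j * r < n
    block-start<n (s , s∈S) j = ℕ.≤-<-trans (ℕ.≤-trans (ℕ.*-monoˡ-≤ r (ℕ.<⇒≤ (Fin.toℕ<n j))) (∈-remaining⁻ r ρ {k} (S⊆R s∈S)))
                                          (Fin.toℕ<n (ρ ⟨$⟩ʳ s))

  S∷blocks-nonempty : .{{_ : NonZero r}} → Nonempty S → ∀ j → Nonempty (S∷blocks j)
  S∷blocks-nonempty S≢∅ zero    = S≢∅
  S∷blocks-nonempty S≢∅ (suc j) = block-nonempty r ρ {toℕ j} (block-start<n S≢∅ j)

  S∷blocks-expect≤ : ∀ δ → GreedyOutput r δ ρ → ∣ S ∣ ≡ r → Nonempty S → ∀ j → expect δ (S∷blocks j) ℚ.≤ expect δ S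
  S∷blocks-expect≤ _ _      _     _   zero    = ℚ.≤-refl
  S∷blocks-expect≤ _ greedy ∣S∣≡r S≢∅ (suc j) =
    greedy (toℕ j) (block-start<n S≢∅ j) S (λ e∈S → remaining-antitone r ρ {toℕ j} {k} (ℕ.<⇒≤ (Fin.toℕ<n j)) (S⊆R e∈S)) ∣S∣≡r

  2+k≤2*expect : ∀ δ → IsProbDist δ → GreedyOutput r δ ρ → ∣ S ∣ ≡ r → .{{_ : NonZero r}} → Nonempty S →
    toℚ (2 + k) ℚ.≤ toℚ 2 ℚ.* expect δ S
  2+k≤2*expect δ δ-prob greedy ∣S∣≡r S≢∅ =
    disjoint-family-bound δ δ-prob S∷blocks (S∷blocks-nonempty S≢∅) S∷blocks-disjoint (expect δ S)
      (S∷blocks-expect≤ δ greedy ∣S∣≡r S≢∅)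

theorem6 : (n r : ℕ) → 1 Data.Nat.≤ r → r ∣ n →
    (δ : Dist n) → IsProbDist δ →
    (ρ : Permutation′ n) → GreedyOutput r δ ρ →
    (S : Subset n) → ∣ S ∣ ≡ r →
    toℚ (minPos ρ S) Data.Rational.≤ toℚ (2 Data.Nat.* r) Data.Rational.* expect δ S
theorem6 n r 1≤r _ δ δ-prob ρ greedy S ∣S∣≡r = begin
  toℚ (minPos ρ S)            ≡⟨ cong toℚ minPos≡pos ⟩
  toℚ (suc p)                 ≤⟨ toℚ-mono-≤ 1+p≤r[2+k] ⟩
  toℚ (r * (2 + k))           ≡⟨ toℚ-homo-* r (2 + k) ⟩
  toℚ r ℚ.* toℚ (2 + k)       ≤⟨ ℚ.*-monoˡ-≤-nonNeg (toℚ r) {{ℚ.normalize-nonNeg r 1}} 2+k≤2E ⟩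
  toℚ r ℚ.* (toℚ 2 ℚ.* E)     ≡⟨ sym (ℚ.*-assoc (toℚ r) (toℚ 2) E) ⟩
  toℚ r ℚ.* toℚ 2 ℚ.* E       ≡⟨ cong (ℚ._* E) (trans (sym (toℚ-homo-* r 2)) (cong toℚ (ℕ.*-comm r 2))) ⟩
  toℚ (2 * r) ℚ.* E           ∎
  where
  open ℚ.≤-Reasoning
  instance
    r≢0 : NonZero r
    r≢0 = ℕ.>-nonZero 1≤r
  E : ℚ
  E = expect δ S
  S≢∅ : Nonempty S
  S≢∅ = ∣p∣>0⇒Nonempty S (subst (0 <_) (sym ∣S∣≡r) 1≤r)
  s : Fin n
  s = proj₁ (minPos-attained ρ S≢∅)
  minPos≡pos : minPos ρ S ≡ pos ρ s
  minPos≡pos = proj₂ (proj₂ (minPos-attained ρ S≢∅))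
  p k : ℕ
  p = toℕ (ρ ⟨$⟩ʳ s)
  k = p / r
  1+p≤r[2+k] : suc p ≤ r * (2 + k)
  1+p≤r[2+k] = ℕ.≤-trans (m<[1+m/n]*n p r) (ℕ.≤-trans (ℕ.≤-reflexive (ℕ.*-comm (suc k) r)) (ℕ.*-monoʳ-≤ r (ℕ.n≤1+n (suc k))))
  S⊆R : S ⊆ remaining r k ρ
  S⊆R e∈S = ∈-remaining⁺ r ρ {k} (ℕ.≤-trans (m/n*n≤m p r) (ℕ.≤-pred (subst (_≤ pos ρ _) minPos≡pos (minPos≤pos ρ e∈S))))
  2+k≤2E : toℚ (2 + k) ℚ.≤ toℚ 2 ℚ.* E
  2+k≤2E = S∷Blocks.2+k≤2*expect ρ {k = k} S⊆R δ δ-prob greedy ∣S∣≡r S≢∅
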